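{- Let $M=(\mathbb{F}_2^n,m)$ be a Boolean multiset and $\varphi:\mathbb{F}_2^n\to\mathbb{F}_2^n$ a linear isomorphism, and let $\varphi(M)=(\mathbb{F}_2^n,m\circ\varphi^{ -1})$. Then $b(\varphi(M))=b(M)$.
   Context: For $\mathbf{x},\mathbf{y}\in\mathbb{F}_2^n$ the pairing is $\mathbf{x}\cdot\mathbf{y}=\sum_{i=1}^n x_iy_i\in\mathbb{F}_2$. A Boolean multiset is a pair $M=(\mathbb{F}_2^n,m)$ with $m:\mathbb{F}_2^n\to\mathbb{Z}_{\geq 0}$; its support is $S_M=\{\mathbf{x}\mid m(\mathbf{x})>0\}$. A vector $\mathbf{y}$ balances $M$ if $\sum_{\mathbf{x}\in S_M}m(\mathbf{x})(-1)^{\mathbf{x}\cdot\mathbf{y}}=0$, and fixes $M$ if $\left|\sum_{\mathbf{x}\in S_M}m(\mathbf{x})(-1)^{\mathbf{x}\cdot\mathbf{y}}\right|=\sum_{\mathbf{x}\in S_M}m(\mathbf{x})$. $B(M)$ is the set of vectors balancing $M$, $C(M)$ the set of vectors fixing $M$, and the balancing number is $b(M)=\#B(M)/\#C(M)$. -}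

module Defs where

open import Data.Bool using (Bool; true; false; _xor_; _∧_)
open import Data.Nat using (ℕ; zero; suc)
open import Data.Integer using (ℤ; +_; -_; ∣_∣) renaming (_+_ to _+ℤ_; _*_ to _*ℤ_)
open import Data.Vec using (Vec; []; _∷_; zipWith; map; foldr)
open import Data.List using (List; []; _∷_; _++_; length; filter)
import Data.List as L
open import Data.Rational using (ℚ; _/_; 0ℚ)
open import Relation.Binary.PropositionalEquality using (_≡_)
open import Relation.Nullary using (¬_)
import Data.Integer.Properties as ℤP
import Data.Nat.Properties as ℕP
open import Data.Nat.ListAction using () renaming (sum to sumℕ)

-- F₂ is modelled by Bool (false = 0, true = 1, xor = +, ∧ = ·).
F2^ : ℕ → Set
F2^ n = Vec Bool n

_⊕_ : ∀ {n} → F2^ n → F2^ n → F2^ n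
_⊕_ = zipWith _xor_

_·ₛ_ : ∀ {n} → Bool → F2^ n → F2^ n
c ·ₛ x = map (c ∧_) x

_·_ : ∀ {n} → F2^ n → F2^ n → Bool
x · y = foldr _ _xor_ false (zipWith _∧_ x y)

sign : Bool → ℤ
sign false = + 1
sign true  = - (+ 1)

allVecs : (n : ℕ) → List (F2^ n)
allVecs zero = [] ∷ []
allVecs (suc n) = L.map (false ∷_) (allVecs n) ++ L.map (true ∷_) (allVecs n)

-- A Boolean multiset on F₂ⁿ is given by its multiplicity function m.
Multiset : ℕ → Set
Multiset n = F2^ n → ℕ

-- Σ_{x ∈ S_M} m(x) (-1)^{x·y}  (terms with m(x) = 0 vanish, so we sum over all x)
charSum : ∀ {n} → Multiset n → F2^ n → ℤ
charSum {n} m y = L.foldr _+ℤ_ (+ 0) (L.map (λ x → (+ m x) *ℤ sign (x · y)) (allVecs n))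

size : ∀ {n} → Multiset n → ℕ
size {n} m = sumℕ (L.map m (allVecs n))

Balances : ∀ {n} → Multiset n → F2^ n → Set
Balances m y = charSum m y ≡ + 0

Fixes : ∀ {n} → Multiset n → F2^ n → Set
Fixes m y = ∣ charSum m y ∣ ≡ size m

#B : ∀ {n} → Multiset n → ℕ
#B {n} m = length (filter (λ y → charSum m y ℤP.≟ + 0) (allVecs n))

#C : ∀ {n} → Multiset n → ℕ
#C {n} m = length (filter (λ y → ∣ charSum m y ∣ ℕP.≟ size m) (allVecs n))

-- b(M) = #B(M) / #C(M).  #C(M) ≥ 1 always (0 fixes M); the zero branch is
-- an unreachable totality convention.
b : ∀ {n} → Multiset n → ℚ
b m with #C m
... | zero  = 0ℚ
... | suc k = (+ #B m) / suc k

-- φ(M) = (F₂ⁿ, m ∘ φ⁻¹)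
image : ∀ {n} → (F2^ n → F2^ n) → Multiset n → Multiset n
image φinv m = λ x → m (φinv x)

IsLinear : ∀ {n} → (F2^ n → F2^ n) → Set
IsLinear {n} φ = (∀ (x y : F2^ n) → φ (x ⊕ y) ≡ φ x ⊕ φ y)
               × (∀ (c : Bool) (x : F2^ n) → φ (c ·ₛ x) ≡ c ·ₛ φ x)
  where open import Data.Product using (_×_)

IsInverse : ∀ {n} → (F2^ n → F2^ n) → (F2^ n → F2^ n) → Set
IsInverse {n} φ ψ = (∀ (x : F2^ n) → ψ (φ x) ≡ x) × (∀ (x : F2^ n) → φ (ψ x) ≡ x)
  where open import Data.Product using (_×_)

-- The transpose τ of φ, defined by φ x · y ≡ x · τ y, is again invertible, and
-- reindexing the character sum of φ(M) along x ↦ φ x shows that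
-- charSum φ(M) y ≡ charSum M (τ y).  Since φ also preserves the total
-- multiplicity, τ maps B(φ(M)) onto B(M) and C(φ(M)) onto C(M), so both counts
-- and hence their ratio are unchanged.
module Submission where

open import Defs
open import Data.Nat using (ℕ)
open import Relation.Binary.PropositionalEquality using (_≡_)

open import Algebra.Core using (Op₂)
open import Algebra.Structures using (IsCommutativeMonoid)
open import Data.Bool using (Bool; true; false; _xor_; _∧_)
open import Data.Bool.Properties
  using (xor-∧-commutativeRing; xor-identityʳ; ∧-assoc; ∧-identityʳ; ∧-zeroʳ; ∧-distribˡ-xor; ∧-distribʳ-xor)
open import Data.Empty using (⊥-elim)
open import Data.Integer using (ℤ; +_; ∣_∣) renaming (_+_ to _+ℤ_; _*_ to _*ℤ_)
import Data.Integer.Properties as ℤP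
open import Data.List as L using (List; []; _∷_; length; filter)
open import Data.List.Membership.Propositional using (_∈_)
open import Data.List.Membership.Propositional.Properties using (∈-map⁺; ∈-map⁻; ∈-++⁺ˡ; ∈-++⁺ʳ)
open import Data.List.Membership.Propositional.Properties.WithK using (unique∧set⇒bag)
open import Data.List.Properties using (map-∘; map-cong)
open import Data.List.Relation.Binary.BagAndSetEquality using (∼bag⇒↭)
open import Data.List.Relation.Binary.Permutation.Propositional using (_↭_; ↭⇒↭ₛ)
open import Data.List.Relation.Binary.Permutation.Propositional.Properties using (↭-length; filter-↭; map⁺)
open import Data.List.Relation.Binary.Permutation.Setoid.Properties using (foldr-commMonoid)
open import Data.List.Relation.Unary.Any using (here)
open import Data.List.Relation.Unary.All using ([])
open import Data.List.Relation.Unary.Unique.Propositional using (Unique; []; _∷_)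
import Data.List.Relation.Unary.Unique.Propositional.Properties as Unique
open import Data.Nat using (zero; suc)
import Data.Nat.Properties as ℕP
open import Data.Nat.ListAction using () renaming (sum to sumℕ)
open import Data.Product using (_×_; _,_; proj₁; proj₂)
open import Data.Rational using (ℚ; _/_; 0ℚ)
open import Data.Vec as V using (Vec; []; _∷_)
open import Data.Vec.Properties using (∷-injectiveʳ)
open import Function using (_∘_)
open import Function.Bundles using (mk⇔)
open import Relation.Binary.PropositionalEquality
  using (refl; sym; trans; cong; cong₂; subst; setoid; module ≡-Reasoning)
open import Relation.Nullary using (¬_; yes; no)
open import Relation.Unary using (Pred; Decidable; _≐_)

open import Algebra.Bundles using (CommutativeRing)
open import Algebra.Properties.CommutativeSemigroup
  (CommutativeRing.+-commutativeSemigroup xor-∧-commutativeRing) using (interchange)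

∈-allVecs : ∀ {n} (x : F2^ n) → x ∈ allVecs n
∈-allVecs [] = here refl
∈-allVecs (false ∷ x) = ∈-++⁺ˡ (∈-map⁺ (false ∷_) (∈-allVecs x))
∈-allVecs {suc n} (true ∷ x) = ∈-++⁺ʳ (L.map (false ∷_) (allVecs n)) (∈-map⁺ (true ∷_) (∈-allVecs x))

allVecs-unique : ∀ n → Unique (allVecs n)
allVecs-unique zero = [] ∷ []
allVecs-unique (suc n) =
  Unique.++⁺ (Unique.map⁺ ∷-injectiveʳ (allVecs-unique n)) (Unique.map⁺ ∷-injectiveʳ (allVecs-unique n)) disjoint
  where
  disjoint : ∀ {v} → ¬ (v ∈ L.map (false ∷_) (allVecs n) × v ∈ L.map (true ∷_) (allVecs n))
  disjoint (p , q) with ∈-map⁻ (false ∷_) p | ∈-map⁻ (true ∷_) q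
  ... | _ , _ , refl | _ , _ , ()

map-allVecs-↭ : ∀ {n} {σ σ⁻¹ : F2^ n → F2^ n} → IsInverse σ σ⁻¹ → L.map σ (allVecs n) ↭ allVecs n
map-allVecs-↭ {n} {σ} {σ⁻¹} (σ⁻¹σ , σσ⁻¹) = ∼bag⇒↭ (unique∧set⇒bag
  (Unique.map⁺ σ-injective (allVecs-unique n)) (allVecs-unique n)
  (λ {y} → mk⇔ (λ _ → ∈-allVecs y) (λ _ → subst (_∈ L.map σ (allVecs n)) (σσ⁻¹ y) (∈-map⁺ σ (∈-allVecs (σ⁻¹ y))))))
  where
  σ-injective : ∀ {x y} → σ x ≡ σ y → x ≡ y
  σ-injective {x} {y} e = trans (sym (σ⁻¹σ x)) (trans (cong σ⁻¹ e) (σ⁻¹σ y))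

module _ {A : Set} {_∙_ : Op₂ A} {ε : A} (isCommutativeMonoid : IsCommutativeMonoid _≡_ _∙_ ε) where

  foldr-allVecs-reindex : ∀ {n} {σ σ⁻¹ : F2^ n → F2^ n} → IsInverse σ σ⁻¹ → (f : F2^ n → A) →
    L.foldr _∙_ ε (L.map (f ∘ σ) (allVecs n)) ≡ L.foldr _∙_ ε (L.map f (allVecs n))
  foldr-allVecs-reindex {n} inv f = trans (cong (L.foldr _∙_ ε) (map-∘ (allVecs n)))
    (foldr-commMonoid (setoid A) isCommutativeMonoid (↭⇒↭ₛ (map⁺ f (map-allVecs-↭ inv))))

length-filter-map : ∀ {A B : Set} {p q} {P : Pred A p} {Q : Pred B q} (P? : Decidable P) (Q? : Decidable Q)
  (f : A → B) → P ≐ Q ∘ f → ∀ xs → length (filter P? xs) ≡ length (filter Q? (L.map f xs))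
length-filter-map P? Q? f P≐Qf [] = refl
length-filter-map P? Q? f P≐Qf (x ∷ xs) with P? x | Q? (f x)
... | yes _  | yes _  = cong suc (length-filter-map P? Q? f P≐Qf xs)
... | yes p  | no ¬q  = ⊥-elim (¬q (proj₁ P≐Qf p))
... | no ¬p  | yes q  = ⊥-elim (¬p (proj₂ P≐Qf q))
... | no _   | no _   = length-filter-map P? Q? f P≐Qf xs

count-allVecs-reindex : ∀ {n p q} {P : Pred (F2^ n) p} {Q : Pred (F2^ n) q} (P? : Decidable P) (Q? : Decidable Q)
  {σ σ⁻¹ : F2^ n → F2^ n} → IsInverse σ σ⁻¹ → P ≐ Q ∘ σ →
  length (filter P? (allVecs n)) ≡ length (filter Q? (allVecs n))
count-allVecs-reindex {n} P? Q? {σ} inv P≐Qσ =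
  trans (length-filter-map P? Q? σ P≐Qσ (allVecs n)) (↭-length (filter-↭ Q? (map-allVecs-↭ inv)))

zeros : ∀ n → F2^ n
zeros n = V.replicate n false

zeros-· : ∀ {n} (u : F2^ n) → zeros n · u ≡ false
zeros-· [] = refl
zeros-· (_ ∷ u) = zeros-· u

zeros-⊕ : ∀ {n} (v : F2^ n) → zeros n ⊕ v ≡ v
zeros-⊕ [] = refl
zeros-⊕ (a ∷ v) = cong (a ∷_) (zeros-⊕ v)

false-·ₛ : ∀ {n} (v : F2^ n) → false ·ₛ v ≡ zeros n
false-·ₛ [] = refl
false-·ₛ (_ ∷ v) = cong (false ∷_) (false-·ₛ v)

·ₛ-zeros : ∀ {n} c → c ·ₛ zeros n ≡ zeros n
·ₛ-zeros {zero} c = refl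
·ₛ-zeros {suc n} c = cong₂ _∷_ (∧-zeroʳ c) (·ₛ-zeros c)

·-distribʳ-⊕ : ∀ {n} (u v y : F2^ n) → (u ⊕ v) · y ≡ (u · y) xor (v · y)
·-distribʳ-⊕ [] [] [] = refl
·-distribʳ-⊕ (a ∷ u) (b ∷ v) (c ∷ y) = begin
  ((a xor b) ∧ c) xor ((u ⊕ v) · y)         ≡⟨ cong₂ _xor_ (∧-distribʳ-xor c a b) (·-distribʳ-⊕ u v y) ⟩
  ((a ∧ c) xor (b ∧ c)) xor (u · y xor v · y) ≡⟨ interchange (a ∧ c) (b ∧ c) (u · y) (v · y) ⟩
  ((a ∧ c) xor u · y) xor ((b ∧ c) xor v · y) ∎
  where open ≡-Reasoning

·ₛ-· : ∀ {n} c (u y : F2^ n) → (c ·ₛ u) · y ≡ c ∧ (u · y)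
·ₛ-· c [] [] = sym (∧-zeroʳ c)
·ₛ-· c (a ∷ u) (d ∷ y) = begin
  ((c ∧ a) ∧ d) xor ((c ·ₛ u) · y) ≡⟨ cong₂ _xor_ (∧-assoc c a d) (·ₛ-· c u y) ⟩
  (c ∧ (a ∧ d)) xor (c ∧ (u · y))  ≡⟨ sym (∧-distribˡ-xor c (a ∧ d) (u · y)) ⟩
  c ∧ ((a ∧ d) xor (u · y))        ∎
  where open ≡-Reasoning

·-nondegenerate : ∀ {n} (u v : F2^ n) → (∀ x → x · u ≡ x · v) → u ≡ v
·-nondegenerate [] [] _ = refl
·-nondegenerate {suc n} (a ∷ u) (b ∷ v) h =
  cong₂ _∷_ a≡b (·-nondegenerate u v (λ x → h (false ∷ x)))
  where
  a≡b : a ≡ b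
  a≡b = begin
    a                           ≡⟨ sym (xor-identityʳ a) ⟩
    a xor false                 ≡⟨ cong (a xor_) (sym (zeros-· u)) ⟩
    (true ∷ zeros n) · (a ∷ u)  ≡⟨ h (true ∷ zeros n) ⟩
    (true ∷ zeros n) · (b ∷ v)  ≡⟨ cong (b xor_) (zeros-· v) ⟩
    b xor false                 ≡⟨ xor-identityʳ b ⟩
    b                           ∎
    where open ≡-Reasoning

basis : ∀ n → Vec (F2^ n) n
basis zero = []
basis (suc n) = (true ∷ zeros n) ∷ V.map (false ∷_) (basis n)

lincomb : ∀ {n k} → Vec Bool k → Vec (F2^ n) k → F2^ n
lincomb {n} [] [] = zeros n
lincomb (c ∷ cs) (v ∷ vs) = (c ·ₛ v) ⊕ lincomb cs vs

lincomb-map-false∷ : ∀ {n k} (cs : Vec Bool k) (vs : Vec (F2^ n) k) →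
  lincomb cs (V.map (false ∷_) vs) ≡ false ∷ lincomb cs vs
lincomb-map-false∷ [] [] = refl
lincomb-map-false∷ (c ∷ cs) (v ∷ vs) rewrite lincomb-map-false∷ cs vs =
  cong (_∷ ((c ·ₛ v) ⊕ lincomb cs vs)) (trans (xor-identityʳ (c ∧ false)) (∧-zeroʳ c))

lincomb-basis : ∀ {n} (x : F2^ n) → lincomb x (basis n) ≡ x
lincomb-basis [] = refl
lincomb-basis {suc n} (a ∷ x) = begin
  (a ·ₛ (true ∷ zeros n)) ⊕ lincomb x (V.map (false ∷_) (basis n)) ≡⟨ cong (_ ⊕_) (lincomb-map-false∷ x (basis n)) ⟩
  (a ∧ true xor false) ∷ ((a ·ₛ zeros n) ⊕ lincomb x (basis n))  ≡⟨ cong₂ _∷_ (trans (xor-identityʳ _) (∧-identityʳ a))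
                                                                     (cong₂ _⊕_ (·ₛ-zeros a) (lincomb-basis x)) ⟩
  a ∷ (zeros n ⊕ x)                                              ≡⟨ cong (a ∷_) (zeros-⊕ x) ⟩
  a ∷ x                                                          ∎
  where open ≡-Reasoning

lincomb-· : ∀ {n k} (cs : Vec Bool k) (vs : Vec (F2^ n) k) (y : F2^ n) →
  lincomb cs vs · y ≡ cs · V.map (_· y) vs
lincomb-· [] [] y = zeros-· y
lincomb-· (c ∷ cs) (v ∷ vs) y = begin
  ((c ·ₛ v) ⊕ lincomb cs vs) · y              ≡⟨ ·-distribʳ-⊕ (c ·ₛ v) (lincomb cs vs) y ⟩
  ((c ·ₛ v) · y) xor (lincomb cs vs · y)      ≡⟨ cong₂ _xor_ (·ₛ-· c v y) (lincomb-· cs vs y) ⟩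
  (c ∧ (v · y)) xor (cs · V.map (_· y) vs)    ∎
  where open ≡-Reasoning

module _ {n} {φ : F2^ n → F2^ n} (φ-linear : IsLinear φ) where

  linear-zeros : φ (zeros n) ≡ zeros n
  linear-zeros = begin
    φ (zeros n)           ≡⟨ cong φ (sym (false-·ₛ (zeros n))) ⟩
    φ (false ·ₛ zeros n)  ≡⟨ proj₂ φ-linear false (zeros n) ⟩
    false ·ₛ φ (zeros n)  ≡⟨ false-·ₛ _ ⟩
    zeros n               ∎
    where open ≡-Reasoning

  linear-lincomb : ∀ {k} (cs : Vec Bool k) (vs : Vec (F2^ n) k) →
    φ (lincomb cs vs) ≡ lincomb cs (V.map φ vs)
  linear-lincomb [] [] = linear-zeros
  linear-lincomb (c ∷ cs) (v ∷ vs) =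
    trans (proj₁ φ-linear (c ·ₛ v) (lincomb cs vs)) (cong₂ _⊕_ (proj₂ φ-linear c v) (linear-lincomb cs vs))

transpose : ∀ {n} → (F2^ n → F2^ n) → F2^ n → F2^ n
transpose {n} φ y = V.map (_· y) (V.map φ (basis n))

transpose-· : ∀ {n} {φ : F2^ n → F2^ n} → IsLinear φ → ∀ x y → φ x · y ≡ x · transpose φ y
transpose-· {n} {φ} φ-linear x y = begin
  φ x · y                            ≡⟨ cong (λ z → φ z · y) (sym (lincomb-basis x)) ⟩
  φ (lincomb x (basis n)) · y        ≡⟨ cong (_· y) (linear-lincomb φ-linear x (basis n)) ⟩
  lincomb x (V.map φ (basis n)) · y  ≡⟨ lincomb-· x _ y ⟩
  x · transpose φ y                  ∎
  where open ≡-Reasoning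

transpose-∘≗id : ∀ {n} {f g : F2^ n → F2^ n} → IsLinear f → IsLinear g → (∀ x → f (g x) ≡ x) →
  ∀ y → transpose g (transpose f y) ≡ y
transpose-∘≗id {f = f} {g} f-linear g-linear fg≗id y = ·-nondegenerate _ _ λ x → begin
  x · transpose g (transpose f y)  ≡⟨ sym (transpose-· g-linear x (transpose f y)) ⟩
  g x · transpose f y              ≡⟨ sym (transpose-· f-linear (g x) y) ⟩
  f (g x) · y                      ≡⟨ cong (_· y) (fg≗id x) ⟩
  x · y                            ∎
  where open ≡-Reasoning

module _ {n} {φ ψ : F2^ n → F2^ n} (φ-linear : IsLinear φ) (φψ-inverse : IsInverse φ ψ) where

  private
    ψφ≗id : ∀ x → ψ (φ x) ≡ x
    ψφ≗id = proj₁ φψ-inverse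

    φψ≗id : ∀ x → φ (ψ x) ≡ x
    φψ≗id = proj₂ φψ-inverse

    ψ-unique : ∀ {u v} → φ v ≡ u → ψ u ≡ v
    ψ-unique {v = v} φv≡u = trans (cong ψ (sym φv≡u)) (ψφ≗id v)

  inverse-linear : IsLinear ψ
  inverse-linear =
    (λ x y → ψ-unique (trans (proj₁ φ-linear (ψ x) (ψ y)) (cong₂ _⊕_ (φψ≗id x) (φψ≗id y)))) ,
    (λ c x → ψ-unique (trans (proj₂ φ-linear c (ψ x)) (cong (c ·ₛ_) (φψ≗id x))))

  transpose-inverse : IsInverse (transpose φ) (transpose ψ)
  transpose-inverse = transpose-∘≗id φ-linear inverse-linear φψ≗id , transpose-∘≗id inverse-linear φ-linear ψφ≗id

module _ {n} {φ ψ : F2^ n → F2^ n} (φ-linear : IsLinear φ) (φψ-inverse : IsInverse φ ψ) (m : Multiset n) where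

  charSum-image : ∀ y → charSum (image ψ m) y ≡ charSum m (transpose φ y)
  charSum-image y = begin
    charSum (image ψ m) y                    ≡⟨ sym (foldr-allVecs-reindex ℤP.+-0-isCommutativeMonoid φψ-inverse term) ⟩
    sumℤ (L.map (term ∘ φ) (allVecs n))      ≡⟨ cong sumℤ (map-cong term∘φ (allVecs n)) ⟩
    charSum m (transpose φ y)                ∎
    where
    open ≡-Reasoning
    sumℤ : List ℤ → ℤ
    sumℤ = L.foldr _+ℤ_ (+ 0)
    term : F2^ n → ℤ
    term x = + m (ψ x) *ℤ sign (x · y)
    term∘φ : ∀ x → term (φ x) ≡ + m x *ℤ sign (x · transpose φ y)
    term∘φ x = cong₂ (λ z s → + m z *ℤ sign s) (proj₁ φψ-inverse x) (transpose-· φ-linear x y)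

  size-image : size (image ψ m) ≡ size m
  size-image = begin
    size (image ψ m)                           ≡⟨ sym (foldr-allVecs-reindex ℕP.+-0-isCommutativeMonoid φψ-inverse (m ∘ ψ)) ⟩
    sumℕ (L.map (m ∘ ψ ∘ φ) (allVecs n))       ≡⟨ cong sumℕ (map-cong (cong m ∘ proj₁ φψ-inverse) (allVecs n)) ⟩
    size m                                     ∎
    where open ≡-Reasoning

  #B-image : #B (image ψ m) ≡ #B m
  #B-image = count-allVecs-reindex _ _ (transpose-inverse φ-linear φψ-inverse)
    ((λ {y} → trans (sym (charSum-image y))) , λ {y} → trans (charSum-image y))

  #C-image : #C (image ψ m) ≡ #C m
  #C-image = count-allVecs-reindex _ _ (transpose-inverse φ-linear φψ-inverse)
    ( (λ {y} fixes → trans (cong ∣_∣ (sym (charSum-image y))) (trans fixes size-image))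
    , (λ {y} fixes → trans (cong ∣_∣ (charSum-image y)) (trans fixes (sym size-image))))

b-cong : ∀ {n} (m m′ : Multiset n) → #B m ≡ #B m′ → #C m ≡ #C m′ → b m ≡ b m′
b-cong m m′ #B≡ #C≡ = trans (b≡ratio m) (trans (cong₂ ratio #B≡ #C≡) (sym (b≡ratio m′)))
  where
  ratio : ℕ → ℕ → ℚ
  ratio _ zero = 0ℚ
  ratio k (suc l) = + k / suc l
  b≡ratio : ∀ {n} (m : Multiset n) → b m ≡ ratio (#B m) (#C m)
  b≡ratio m with #C m
  ... | zero  = refl
  ... | suc _ = refl

proposition12 : (n : ℕ) (m : Multiset n) (φ φ⁻¹ : F2^ n → F2^ n) →
    IsLinear φ → IsInverse φ φ⁻¹ →
    b (image φ⁻¹ m) ≡ b m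
proposition12 n m φ φ⁻¹ φ-linear φφ⁻¹-inverse =
  b-cong (image φ⁻¹ m) m (#B-image φ-linear φφ⁻¹-inverse m) (#C-image φ-linear φφ⁻¹-inverse m)
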